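{- Let $A$ be a set and $w\in A^*$ not flat with $|w|\ge2$, under ordinary factor order. (1) The interval $[i(w),w]$ has exactly two maximal chains, and if $C$ is the second one in lexicographic order of chain ids, then $C(w,i(w))$ is its unique minimally skipped interval. (2) If $o(w)\not< i(w)$, the interval $[o(w),w]$ has exactly two maximal chains, and if $C$ is the second one, then $C(w,o(w))$ is its unique minimally skipped interval.
   Context: Ordinary factor order on words over $A$: $u\le w$ iff $u$ is a block of consecutive letters of $w$. - Flat: all letters equal. - $o(w)$: the longest word that is both a proper prefix and a proper suffix of $w$. - $i(w)=w(2)\cdots w(|w|-1)$. Chain ids. Let $0\notin A$. For a maximal chain $w=v_0\to\dots\to v_n$, set $\eta_{v_0}=w$, and obtain $\eta_{v_k}$ by replacing with $0$ the letter at position $l_k$. This is the first nonzero letter if $v_k$ is $v_{k-1}$ minus its first letter, and otherwise the last nonzero letter; the first if $v_{k-1}$ is flat. Chains are ordered lexicographically by chain id $l_1\cdots l_n$. Skipped intervals. A nonempty $C(v_a,v_b)=\{v_{a+1},\dots,v_{b-1}\}$ is skipped if $C\setminus C(v_a,v_b)\subseteq C'$ for some earlier maximal chain $C'$. It is minimally skipped if it properly contains no skipped interval. -}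

module Defs where

open import Data.Nat using (ℕ; zero; suc; _≤_; _<_; _∸_)
open import Data.List using (List; []; _∷_; _++_; length; map; drop; take; lookup)
open import Data.List.Membership.Propositional using (_∈_)
open import Data.List.Relation.Unary.Linked using (Linked)
open import Data.List.Relation.Binary.Lex.Strict using (Lex-<)
open import Data.Maybe using (Maybe; just; nothing)
open import Data.Fin using (Fin; toℕ)
open import Data.Product using (Σ; ∃; ∃-syntax; _×_; _,_)
open import Data.Sum using (_⊎_)
open import Data.Empty using (⊥)
open import Relation.Nullary using (¬_)
open import Relation.Binary.PropositionalEquality using (_≡_; _≢_)
open import Function.Bundles using (_⇔_)

-- Generic 1-indexed access / update on lists (positions 1,2,...)

pos : ∀ {X : Set} → List X → ℕ → Maybe X
pos xs zero = nothing
pos [] (suc n) = nothing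
pos (x ∷ xs) (suc zero) = just x
pos (x ∷ xs) (suc (suc n)) = pos xs (suc n)

setPos : ∀ {X : Set} → List X → ℕ → X → List X
setPos xs zero y = xs
setPos [] (suc n) y = []
setPos (x ∷ xs) (suc zero) y = y ∷ xs
setPos (x ∷ xs) (suc (suc n)) y = x ∷ setPos xs (suc n) y

module _ {A : Set} where

  Word : Set
  Word = List A

  _≤F_ : Word → Word → Set
  u ≤F w = ∃[ p ] ∃[ s ] (p ++ u ++ s ≡ w)

  _<F_ : Word → Word → Set
  u <F w = u ≤F w × u ≢ w

  _⋖_ : Word → Word → Set
  u ⋖ w = u <F w × (∀ z → u <F z → z <F w → ⊥)

  Flat : Word → Set
  Flat w = ∀ {x y} → x ∈ w → y ∈ w → x ≡ y

  inner : Word → Word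
  inner w = take (length w ∸ 2) (drop 1 w)

  ProperPrefix : Word → Word → Set
  ProperPrefix u w = ∃[ s ] (s ≢ [] × u ++ s ≡ w)

  ProperSuffix : Word → Word → Set
  ProperSuffix u w = ∃[ p ] (p ≢ [] × p ++ u ≡ w)

  IsO : Word → Word → Set
  IsO w u = ProperPrefix u w × ProperSuffix u w ×
            (∀ v → ProperPrefix v w → ProperSuffix v w → length v ≤ length u)

  -- Maximal chains of the interval [u,w], listed from the top:
  -- w = v₀ ⋗ v₁ ⋗ ... ⋗ vₙ = u

  Last : Word → List Word → Set
  Last u [] = ⊥
  Last u (v ∷ []) = v ≡ u
  Last u (v ∷ v' ∷ vs) = Last u (v' ∷ vs)

  MaxChain : Word → Word → List Word → Set
  MaxChain u w C =
    (∃[ rest ] (C ≡ w ∷ rest)) × Last u C × Linked (λ x y → y ⋖ x) C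

  -- Chain ids.  η-words are lists over Maybe A, with nothing playing the
  -- role of the letter 0 ∉ A.

  Eta : Set
  Eta = List (Maybe A)

  NonZeroAt : Eta → ℕ → Set
  NonZeroAt η l = ∃[ a ] (pos η l ≡ just (just a))

  FirstNZ : Eta → ℕ → Set
  FirstNZ η l = NonZeroAt η l × (∀ k → 1 ≤ k → k < l → pos η k ≡ just nothing)

  LastNZ : Eta → ℕ → Set
  LastNZ η l = NonZeroAt η l × (∀ k → l < k → k ≤ length η → pos η k ≡ just nothing)

  data Choice (prev next : Word) (η : Eta) (l : ℕ) : Set where
    flat      : Flat prev → FirstNZ η l → Choice prev next η l
    fromFront : ¬ Flat prev → next ≡ drop 1 prev → FirstNZ η l → Choice prev next η l
    fromBack  : ¬ Flat prev → next ≢ drop 1 prev → LastNZ η l → Choice prev next η l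

  data IdsFrom : Eta → Word → List Word → List ℕ → Set where
    done : ∀ {η v} → IdsFrom η v [] []
    step : ∀ {η v v' vs l ls} → Choice v v' η l →
           IdsFrom (setPos η l nothing) v' vs ls →
           IdsFrom η v (v' ∷ vs) (l ∷ ls)

  ChainId : List Word → List ℕ → Set
  ChainId [] ids = ⊥
  ChainId (v ∷ vs) ids = IdsFrom (map just v) v vs ids

  Earlier : List Word → List Word → Set
  Earlier C' C = ∃[ ids' ] ∃[ ids ]
    (ChainId C' ids' × ChainId C ids × Lex-< _≡_ _<_ ids' ids)

  -- Skipped intervals of a maximal chain C = v₀ ... vₙ of [u,w].
  -- The interval C(v_a,v_b) = {v_{a+1},...,v_{b-1}} is given by indices
  -- a < b ≤ n; nonempty means a + 1 < b.

  Skipped : Word → Word → List Word → ℕ → ℕ → Set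
  Skipped u w C a b =
    suc a < b × suc b ≤ length C ×
    ∃[ C' ] (MaxChain u w C' × Earlier C' C ×
      (∀ (i : Fin (length C)) → (toℕ i ≤ a ⊎ b ≤ toℕ i) → lookup C i ∈ C'))

  MinSkipped : Word → Word → List Word → ℕ → ℕ → Set
  MinSkipped u w C a b =
    Skipped u w C a b ×
    (∀ a' b' → Skipped u w C a' b' → a ≤ a' → b' ≤ b → a' ≡ a × b' ≡ b)

  ExactlyTwoMaxChains : Word → Word → Set
  ExactlyTwoMaxChains u w = ∃[ C₁ ] ∃[ C₂ ]
    (MaxChain u w C₁ × MaxChain u w C₂ × C₁ ≢ C₂ ×
     (∀ C → MaxChain u w C → C ≡ C₁ ⊎ C ≡ C₂))

  -- if C is the second maximal chain (some maximal chain of [u,w] is earlier),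
  -- then C(w,u) = C(v₀,vₙ) is its unique minimally skipped interval
  SecondHasUniqueMinSkipped : Word → Word → Set
  SecondHasUniqueMinSkipped u w =
    ∀ C → MaxChain u w C → (∃[ C' ] (MaxChain u w C' × Earlier C' C)) →
    ∀ a b → MinSkipped u w C a b ⇔ (a ≡ 0 × b ≡ length C ∸ 1)

-- A maximal chain in factor order deletes one letter at a time, either the first
-- or the last.  In [i(w), w] a chain has two steps, and its middle word is either
-- m b or a m (w = a m b); these differ because w is not flat.  In [o(w), w], if a
-- chain, after deleting at one end, deletes at the other end, the new word is a
-- factor of i(w) lying above o(w); as o(w) ≮ i(w) it is o(w) itself, which is
-- both a prefix and a suffix.  So every chain consists of prefixes of w or of
-- suffixes of w, and such chains are determined by their lengths.  An interior
-- word of one chain never lies on the other: it would be a border of w longer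
-- than o(w).  Chain ids determine chains, so the earlier chain is the other one
-- and every skipped interval of the second chain must cover its whole interior.

module Submission where

open import Defs
open import Data.Nat using (ℕ; zero; suc; _+_; _∸_; _≤_; _<_; z≤n; s≤s; s≤s⁻¹; z<s; _≟_)
open import Data.Nat.Properties
open import Data.List using (List; []; _∷_; _++_; _∷ʳ_; [_]; length; map; reverse; take; lookup)
open import Data.List.Properties
  using (++-assoc; ++-identityʳ; ++-cancelˡ; length-++; ∷-injectiveˡ; ∷-injectiveʳ; ∷ʳ-injectiveˡ;
         unfold-reverse; reverse-++; reverse-involutive)
open import Data.List.Reverse using (reverseView; []; _∶_∶ʳ_)
open import Data.List.Membership.Propositional using (_∈_; _∉_)
open import Data.List.Membership.Propositional.Properties using (∈-lookup)
open import Data.List.Relation.Unary.All as All using (All; []; _∷_)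
open import Data.List.Relation.Unary.All.Properties as All using ()
open import Data.List.Relation.Unary.Any using (here; there)
open import Data.List.Relation.Unary.Linked as Linked using (Linked; [-]; _∷_)
open import Data.List.Relation.Unary.Linked.Properties as Linked using ()
open import Data.List.Relation.Binary.Lex.Strict using (<-irreflexive)
open import Data.List.Relation.Binary.Pointwise using (≡⇒Pointwise-≡)
open import Data.Fin using (Fin; zero; suc; toℕ; fromℕ<)
open import Data.Fin.Properties using (toℕ-fromℕ<)
open import Data.Maybe using (Maybe; just; nothing)
open import Data.Product using (∃-syntax; _×_; _,_; proj₁; proj₂)
open import Data.Sum using (_⊎_; inj₁; inj₂)
open import Data.Empty using (⊥; ⊥-elim)
open import Function using (_∘′_; flip)
open import Function.Bundles using (mk⇔)
open import Relation.Nullary using (¬_; yes; no; contradiction)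
open import Relation.Binary.PropositionalEquality hiding ([_])

module _ {A : Set} where

  private variable
    a b c : A
    m p s t u v w x y z : List A
    r r' C D : List (List A)
    P Q : List A → Set
    η : List (Maybe A)
    l l' : ℕ
    ids ids' : List ℕ

  ≤F-refl : u ≤F u
  ≤F-refl {u} = [] , [] , ++-identityʳ u

  ≤F-trans : u ≤F v → v ≤F w → u ≤F w
  ≤F-trans {u} (p , s , refl) (p' , s' , refl) = p' ++ p , s ++ s' , (begin
    (p' ++ p) ++ u ++ s ++ s'   ≡⟨ ++-assoc p' p _ ⟩
    p' ++ p ++ u ++ s ++ s'     ≡⟨ cong (λ q → p' ++ p ++ q) (++-assoc u s s') ⟨
    p' ++ p ++ (u ++ s) ++ s'   ≡⟨ cong (p' ++_) (++-assoc p (u ++ s) s') ⟨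
    p' ++ (p ++ u ++ s) ++ s'   ∎)
    where open ≡-Reasoning

  ≤F-length : u ≤F v → length u ≤ length v
  ≤F-length {u} (p , s , refl) = begin
    length u                    ≤⟨ m≤m+n _ _ ⟩
    length u + length s         ≡⟨ length-++ u ⟨
    length (u ++ s)             ≤⟨ m≤n+m _ _ ⟩
    length p + length (u ++ s)  ≡⟨ length-++ p ⟨
    length (p ++ u ++ s)        ∎
    where open ≤-Reasoning

  ≤F-length-≡ : u ≤F v → length u ≡ length v → u ≡ v
  ≤F-length-≡ {u} ([] , [] , refl) _ = sym (++-identityʳ u)
  ≤F-length-≡ {u} ([] , c ∷ s , refl) eq =
    contradiction (trans eq (length-++ u)) (<⇒≢ (m<m+n _ (s≤s z≤n)))
  ≤F-length-≡ {u} (c ∷ p , s , refl) eq =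
    contradiction eq (<⇒≢ (s≤s (≤F-length (p , s , refl))))

  <F-length : u <F v → length u < length v
  <F-length (u≤v , u≢v) = ≤∧≢⇒< (≤F-length u≤v) (u≢v ∘′ ≤F-length-≡ u≤v)

  ≤F∧≮F⇒≡ : u ≤F v → ¬ u <F v → u ≡ v
  ≤F∧≮F⇒≡ {u} {v} u≤v u≮v with length u ≟ length v
  ... | yes eq  = ≤F-length-≡ u≤v eq
  ... | no  neq = contradiction (u≤v , λ { refl → neq refl }) u≮v

  ∷ʳ-length : (x : List A) (c : A) → length (x ∷ʳ c) ≡ suc (length x)
  ∷ʳ-length x c = trans (length-++ x) (+-comm (length x) 1)

  ∷-≢ : x ≢ c ∷ x
  ∷-≢ eq = <-irrefl (cong length eq) (n<1+n _)

  ∷ʳ-≢ : x ≢ x ∷ʳ c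
  ∷ʳ-≢ {x} {c} eq = <-irrefl (trans (cong length eq) (∷ʳ-length x c)) (n<1+n _)

  ⋖-intro : u ≤F v → suc (length u) ≡ length v → u ⋖ v
  ⋖-intro {u} {v} u≤v eq = (u≤v , λ { refl → <-irrefl (sym eq) (n<1+n _) }) , λ z u<z z<v →
    <-irrefl refl (≤-<-trans (<F-length u<z) (<-≤-trans (<F-length z<v) (≤-reflexive (sym eq))))

  ∷-⋖ : c ∷ u ≡ v → u ⋖ v
  ∷-⋖ {c} {u} refl = ⋖-intro ([ c ] , [] , cong (c ∷_) (++-identityʳ u)) refl

  ∷ʳ-⋖ : u ∷ʳ c ≡ v → u ⋖ v
  ∷ʳ-⋖ {u} {c} refl = ⋖-intro ([] , [ c ] , refl) (sym (∷ʳ-length u c))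

  ⋖-cases : u ⋖ v → (∃[ c ] c ∷ u ≡ v) ⊎ (∃[ c ] u ∷ʳ c ≡ v)
  ⋖-cases {u} (((c ∷ p , s , refl) , _) , max) =
    inj₁ (c , cong (c ∷_) (≤F∧≮F⇒≡ (p , s , refl) λ u<z → max _ u<z (proj₁ (∷-⋖ refl))))
  ⋖-cases {u} ((([] , s , refl) , u≢v) , max) with reverseView s
  ... | [] = contradiction (sym (++-identityʳ u)) u≢v
  ... | s' ∶ _ ∶ʳ c = inj₂ (c , trans (cong (_∷ʳ c) u≡u++s') (++-assoc u s' [ c ]))
    where
      u≡u++s' : u ≡ u ++ s'
      u≡u++s' = ≤F∧≮F⇒≡ ([] , s' , refl) λ u<z →
        max _ u<z (subst ((u ++ s') <F_) (++-assoc u s' [ c ]) (proj₁ (∷ʳ-⋖ refl)))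

  ⋖-length : u ⋖ v → suc (length u) ≡ length v
  ⋖-length {u} u⋖v with ⋖-cases u⋖v
  ... | inj₁ (c , refl) = refl
  ... | inj₂ (c , refl) = sym (∷ʳ-length u c)

  ⋖-reverse : u ⋖ v → reverse u ⋖ reverse v
  ⋖-reverse {u} u⋖v with ⋖-cases u⋖v
  ... | inj₁ (c , refl) = ∷ʳ-⋖ (sym (unfold-reverse c u))
  ... | inj₂ (c , refl) = ∷-⋖ (sym (reverse-++ u [ c ]))

  Prefix Suffix : List A → List A → Set
  Prefix u w = ∃[ s ] (u ++ s ≡ w)
  Suffix u w = ∃[ p ] (p ++ u ≡ w)

  ++-cancelʳ-length : (x y : List A) → length x ≡ length y → x ++ s ≡ y ++ t → x ≡ y
  ++-cancelʳ-length []      []      _   _  = refl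
  ++-cancelʳ-length (a ∷ x) (b ∷ y) len eq =
    cong₂ _∷_ (∷-injectiveˡ eq) (++-cancelʳ-length x y (suc-injective len) (∷-injectiveʳ eq))

  prefix-unique : Prefix x w → Prefix y w → length x ≡ length y → x ≡ y
  prefix-unique {x} {y = y} (_ , refl) (_ , eq) len = ++-cancelʳ-length x y len (sym eq)

  suffix-unique : Suffix x w → Suffix y w → length x ≡ length y → x ≡ y
  suffix-unique {x} {y = y} (p , refl) (q , eq) len =
    ++-cancelˡ p x y (trans (sym eq) (cong (_++ y) (sym p≡q)))
    where
      open ≡-Reasoning
      p≡q : p ≡ q
      p≡q = ++-cancelʳ-length p q (+-cancelʳ-≡ (length x) _ _ (begin
        length p + length x   ≡⟨ length-++ p ⟨
        length (p ++ x)       ≡⟨ cong length eq ⟨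
        length (q ++ y)       ≡⟨ length-++ q ⟩
        length q + length y   ≡⟨ cong (length q +_) len ⟨
        length q + length x   ∎)) (sym eq)

  prefix⇒proper : Prefix x w → length x < length w → ProperPrefix x w
  prefix⇒proper {x} (s , eq) x<w =
    s , (λ { refl → <-irrefl (cong length (trans (sym (++-identityʳ x)) eq)) x<w }) , eq

  suffix⇒proper : Suffix x w → length x < length w → ProperSuffix x w
  suffix⇒proper (p , eq) x<w = p , (λ { refl → <-irrefl (cong length eq) x<w }) , eq

  properPrefix-length : ProperPrefix x w → length x < length w
  properPrefix-length {x} (s , s≢[] , eq) = <F-length (([] , s , eq) ,
    λ { refl → s≢[] (++-cancelˡ x s [] (trans eq (sym (++-identityʳ x)))) })

  proper⇒prefix : ProperPrefix x w → Prefix x w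
  proper⇒prefix (s , _ , eq) = s , eq

  proper⇒suffix : ProperSuffix x w → Suffix x w
  proper⇒suffix (p , _ , eq) = p , eq

  away-from-ends⇒≤F-inner : p ++ y ++ s ≡ a ∷ m ∷ʳ b → p ≢ [] → s ≢ [] → y ≤F m
  away-from-ends⇒≤F-inner {[]} _ p≢[] _ = contradiction refl p≢[]
  away-from-ends⇒≤F-inner {c ∷ p} {y} {s} eq _ s≢[] with reverseView s
  ... | [] = contradiction refl s≢[]
  ... | s' ∶ _ ∶ʳ d = p , s' , ∷ʳ-injectiveˡ (p ++ y ++ s') _ (begin
    (p ++ y ++ s') ∷ʳ d   ≡⟨ ++-assoc p (y ++ s') [ d ] ⟩
    p ++ (y ++ s') ∷ʳ d   ≡⟨ cong (p ++_) (++-assoc y s' [ d ]) ⟩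
    p ++ y ++ s' ∷ʳ d     ≡⟨ ∷-injectiveʳ eq ⟩
    _                     ∎)
    where open ≡-Reasoning

  _⋗_ : List A → List A → Set
  x ⋗ y = y ⋖ x

  last-≤F : Linked _⋗_ (x ∷ r) → Last u (x ∷ r) → u ≤F x
  last-≤F {r = []}    [-]          refl = ≤F-refl
  last-≤F {r = _ ∷ _} (y⋖x ∷ lk) lst  = ≤F-trans (last-≤F lk lst) (proj₁ (proj₁ y⋖x))

  chain-length : Linked _⋗_ (x ∷ r) → Last u (x ∷ r) → length u + length r ≡ length x
  chain-length {r = []}    [-]          refl = +-identityʳ _
  chain-length {x} {y ∷ r} {u} (y⋖x ∷ lk) lst = begin
    length u + suc (length r)   ≡⟨ +-suc (length u) (length r) ⟩
    suc (length u + length r)   ≡⟨ cong suc (chain-length lk lst) ⟩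
    suc (length y)              ≡⟨ ⋖-length y⋖x ⟩
    length x                    ∎
    where open ≡-Reasoning

  lookup-length : Linked _⋗_ (x ∷ r) → (i : Fin (length (x ∷ r))) →
    toℕ i + length (lookup (x ∷ r) i) ≡ length x
  lookup-length _            zero    = refl
  lookup-length (y⋖x ∷ lk) (suc i) = trans (cong suc (lookup-length lk i)) (⋖-length y⋖x)

  all-along-chain : (∀ {x y} → P x → x ⋗ y → u ≤F y → P y) →
    Linked _⋗_ (x ∷ r) → Last u (x ∷ r) → P x → All P (x ∷ r)
  all-along-chain preserve [-]          _   px = px ∷ []
  all-along-chain preserve (y⋖x ∷ lk) lst px =
    px ∷ all-along-chain preserve lk lst (preserve px y⋖x (last-≤F lk lst))

  LengthDetermined : (List A → Set) → Set
  LengthDetermined P = ∀ {x y} → P x → P y → length x ≡ length y → x ≡ y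

  chain-unique : LengthDetermined P →
    Linked _⋗_ (x ∷ r)  → Last u (x ∷ r)  → All P r →
    Linked _⋗_ (x ∷ r') → Last u (x ∷ r') → All P r' → r ≡ r'
  chain-unique {r = []} {r' = []} _ _ _ _ _ _ _ = refl
  chain-unique {r = []} {r' = _ ∷ _} _ lk lst _ lk' lst' _ =
    contradiction (+-cancelˡ-≡ _ _ _ (trans (chain-length lk lst) (sym (chain-length lk' lst')))) 0≢1+n
  chain-unique {r = _ ∷ _} {r' = []} _ lk lst _ lk' lst' _ =
    contradiction (+-cancelˡ-≡ _ _ _ (trans (chain-length lk' lst') (sym (chain-length lk lst)))) 0≢1+n
  chain-unique {r = y ∷ _} det (y⋖x ∷ lk) lst (py ∷ ps) (y'⋖x ∷ lk') lst' (py' ∷ ps')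
    with det py py' (suc-injective (trans (⋖-length y⋖x) (sym (⋖-length y'⋖x))))
  ... | refl = cong (y ∷_) (chain-unique det lk lst ps lk' lst' ps')

  maxChain-unique : LengthDetermined P → MaxChain u w C → MaxChain u w D → All P C → All P D → C ≡ D
  maxChain-unique det ((_ , refl) , lst , lk) ((_ , refl) , lst' , lk') (_ ∷ ps) (_ ∷ ps') =
    cong (_ ∷_) (chain-unique det lk lst ps lk' lst' ps')

  length-maxChain : MaxChain u w C → length u + length C ≡ suc (length w)
  length-maxChain {u} ((r , refl) , lst , lk) =
    trans (+-suc (length u) (length r)) (cong suc (chain-length lk lst))

  Last-map : (f : List A → List A) {C : List (List A)} → Last u C → Last (f u) (map f C)
  Last-map f {C = _ ∷ []}    refl = refl
  Last-map f {C = _ ∷ y ∷ C} lst  = Last-map f {C = y ∷ C} lst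

  Last⇒∈ : Last u C → u ∈ C
  Last⇒∈ {C = _ ∷ []}    refl = here refl
  Last⇒∈ {C = _ ∷ y ∷ C} lst  = there (Last⇒∈ {C = y ∷ C} lst)

  lookup-last : Last u C → (i : Fin (length C)) → length C ∸ 1 ≤ toℕ i → lookup C i ≡ u
  lookup-last {C = _ ∷ []}    lst  zero    _  = lst
  lookup-last {C = _ ∷ _ ∷ _} _    zero    ()
  lookup-last {C = _ ∷ y ∷ C} lst  (suc i) le = lookup-last {C = y ∷ C} lst i (s≤s⁻¹ le)

  maxChain-reverse : MaxChain u w C → MaxChain (reverse u) (reverse w) (map reverse C)
  maxChain-reverse ((r , refl) , lst , lk) =
    (map reverse r , refl) , Last-map reverse {_ ∷ r} lst , Linked.map⁺ (Linked.map ⋖-reverse lk)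

  suffixChain : List A → List A → List (List A)
  suffixChain []      u = u ∷ []
  suffixChain (c ∷ p) u = (c ∷ p ++ u) ∷ suffixChain p u

  suffixChain-maxChain : p ++ u ≡ w → MaxChain u w (suffixChain p u)
  suffixChain-maxChain {p} refl = head p , last p , linked p
    where
      head : ∀ p → ∃[ r ] suffixChain p u ≡ (p ++ u) ∷ r
      head []      = _ , refl
      head (_ ∷ _) = _ , refl
      last : ∀ p → Last u (suffixChain p u)
      last []          = refl
      last (_ ∷ [])    = refl
      last (_ ∷ d ∷ p) = last (d ∷ p)
      linked : ∀ p → Linked _⋗_ (suffixChain p u)
      linked []          = [-]
      linked (_ ∷ [])    = ∷-⋖ refl ∷ [-]
      linked (_ ∷ d ∷ p) = ∷-⋖ refl ∷ linked (d ∷ p)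

  suffixChain-suffixes : (p : List A) → All (λ y → Suffix y (p ++ u)) (suffixChain p u)
  suffixChain-suffixes []      = ([] , refl) ∷ []
  suffixChain-suffixes (c ∷ p) =
    ([] , refl) ∷ All.map (λ (q , eq) → c ∷ q , cong (c ∷_) eq) (suffixChain-suffixes p)

  -- removes the letters of s one at a time from the back
  prefixChain : List A → List A → List (List A)
  prefixChain u s = map reverse (suffixChain (reverse s) (reverse u))

  reverse-reverse-++ : (u s : List A) → reverse (reverse s ++ reverse u) ≡ u ++ s
  reverse-reverse-++ u s =
    trans (reverse-++ (reverse s) (reverse u)) (cong₂ _++_ (reverse-involutive u) (reverse-involutive s))

  suffix-reverse : Suffix y w → Prefix (reverse y) (reverse w)
  suffix-reverse {y} (q , refl) = reverse q , sym (reverse-++ q y)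

  prefixChain-maxChain : u ++ s ≡ w → MaxChain u w (prefixChain u s)
  prefixChain-maxChain {u} {s} refl =
    subst₂ (λ u' w' → MaxChain u' w' (prefixChain u s)) (reverse-involutive u) (reverse-reverse-++ u s)
      (maxChain-reverse (suffixChain-maxChain refl))

  prefixChain-prefixes : (u s : List A) → All (λ y → Prefix y (u ++ s)) (prefixChain u s)
  prefixChain-prefixes u s =
    All.map⁺ (All.map (subst (Prefix _) (reverse-reverse-++ u s) ∘′ suffix-reverse)
                      (suffixChain-suffixes (reverse s)))

  pos-length : {X : Set} (xs : List X) (n : ℕ) {x : X} → pos xs n ≡ just x → n ≤ length xs
  pos-length (_ ∷ _)  1               _  = s≤s z≤n
  pos-length (_ ∷ xs) (suc (suc n)) eq = s≤s (pos-length xs (suc n) eq)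

  nonzero-pos : (η : List (Maybe A)) (l : ℕ) → NonZeroAt η l → 1 ≤ l
  nonzero-pos _ (suc _) _ = s≤s z≤n

  nothing≢just : {o : Maybe (Maybe A)} → o ≡ just nothing → ¬ o ≡ just (just a)
  nothing≢just refl ()

  firstNZ-≤ : FirstNZ η l → NonZeroAt η l' → l ≤ l'
  firstNZ-≤ {η} {l' = l'} (_ , before) (_ , eq) =
    ≮⇒≥ λ l'<l → nothing≢just (before l' (nonzero-pos η l' (_ , eq)) l'<l) eq

  lastNZ-≥ : LastNZ η l → NonZeroAt η l' → l' ≤ l
  lastNZ-≥ {η} {l' = l'} (_ , after) (_ , eq) =
    ≮⇒≥ λ l<l' → nothing≢just (after l' l<l' (pos-length η l' eq)) eq

  firstNZ-unique : FirstNZ η l → FirstNZ η l' → l ≡ l'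
  firstNZ-unique f f' = ≤-antisym (firstNZ-≤ f (proj₁ f')) (firstNZ-≤ f' (proj₁ f))

  lastNZ-unique : LastNZ η l → LastNZ η l' → l ≡ l'
  lastNZ-unique f f' = ≤-antisym (lastNZ-≥ f' (proj₁ f)) (lastNZ-≥ f (proj₁ f'))

  choice-unique : Choice x y η l → Choice x y η l' → l ≡ l'
  choice-unique (flat _ f)            (flat _ f')           = firstNZ-unique f f'
  choice-unique (flat fl _)           (fromFront ¬fl _ _)   = ⊥-elim (¬fl fl)
  choice-unique (flat fl _)           (fromBack ¬fl _ _)    = ⊥-elim (¬fl fl)
  choice-unique (fromFront ¬fl _ _)   (flat fl _)           = ⊥-elim (¬fl fl)
  choice-unique (fromFront _ _ f)     (fromFront _ _ f')    = firstNZ-unique f f'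
  choice-unique (fromFront _ front _) (fromBack _ ¬front _) = contradiction front ¬front
  choice-unique (fromBack ¬fl _ _)    (flat fl _)           = ⊥-elim (¬fl fl)
  choice-unique (fromBack _ ¬front _) (fromFront _ front _) = contradiction front ¬front
  choice-unique (fromBack _ _ f)      (fromBack _ _ f')     = lastNZ-unique f f'

  idsFrom-unique : IdsFrom η x r ids → IdsFrom η x r ids' → ids ≡ ids'
  idsFrom-unique done done = refl
  idsFrom-unique (step ch rest) (step ch' rest') with choice-unique ch ch'
  ... | refl = cong (_ ∷_) (idsFrom-unique rest rest')

  Earlier-irrefl : ¬ Earlier C C
  Earlier-irrefl {_ ∷ _} (_ , _ , id , id' , lt) with idsFrom-unique id id'
  ... | refl = <-irreflexive <-irrefl (≡⇒Pointwise-≡ refl) lt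

  Interior : (List A → Set) → List (List A) → Set
  Interior P C = ∀ (i : Fin (length C)) → 0 < toℕ i → suc (toℕ i) < length C → P (lookup C i)

  interior-length : MaxChain u w C → Interior (λ y → length u < length y × length y < length w) C
  interior-length {u} {w} ((r , refl) , lst , lk) i 0<i i<r = u<y , y<w
    where
      open ≤-Reasoning
      L : ℕ
      L = length (lookup (w ∷ r) i)
      u<y : length u < L
      u<y = +-cancelʳ-< (length r) (length u) L (begin-strict
        length u + length r  ≡⟨ trans (chain-length lk lst) (sym (lookup-length lk i)) ⟩
        toℕ i + L            <⟨ +-monoˡ-< L (s≤s⁻¹ i<r) ⟩
        length r + L         ≡⟨ +-comm (length r) L ⟩
        L + length r         ∎)
      y<w : L < length w
      y<w = <-≤-trans (m<n+m L 0<i) (≤-reflexive (lookup-length lk i))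

  apart : (∀ {y} → P y → Q y → length u < length y → length y < length w → ⊥) →
    MaxChain u w C → All P C → All Q D → Interior (_∉ D) C
  apart clash mc allP allQ i 0<i i<C y∈D with interior-length mc i 0<i i<C
  ... | u<y , y<w = clash (All.lookup allP (∈-lookup i)) (All.lookup allQ y∈D) u<y y<w

  apart⇒≢ : 3 ≤ length C → Interior (_∉ D) C → C ≢ D
  apart⇒≢ {_ ∷ []}         (s≤s ())
  apart⇒≢ {_ ∷ _ ∷ []}     (s≤s (s≤s ()))
  apart⇒≢ {_ ∷ _ ∷ _ ∷ _} _ apart refl = apart (suc zero) (s≤s z≤n) (s≤s (s≤s (s≤s z≤n))) (there (here refl))

  maxChain-long : 2 + length u ≤ length w → MaxChain u w C → 3 ≤ length C
  maxChain-long {u} {w} {C} gap mc = +-cancelˡ-≤ (length u) 3 (length C) (begin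
    length u + 3        ≡⟨ +-comm (length u) 3 ⟩
    3 + length u        ≤⟨ s≤s gap ⟩
    suc (length w)      ≡⟨ length-maxChain mc ⟨
    length u + length C ∎)
    where open ≤-Reasoning

  skipped-spans : (∀ {D} → MaxChain u w D → Earlier D C → Interior (_∉ D) C) →
    ∀ {k n} → Skipped u w C k n → k ≡ 0 × n ≡ length C ∸ 1
  skipped-spans {C = C} apartFrom {k} {n} (k+1<n , n<C , D , mcD , earlier , kept) = k≡0 , n≡last
    where
      keptInterior : ∀ j (j<C : j < length C) → toℕ (fromℕ< j<C) ≤ k ⊎ n ≤ toℕ (fromℕ< j<C) →
        0 < j → suc j < length C → ⊥
      keptInterior j j<C side 0<j j+1<C =
        apartFrom mcD earlier (fromℕ< j<C)
          (subst (0 <_) (sym (toℕ-fromℕ< j<C)) 0<j)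
          (subst (λ t → suc t < length C) (sym (toℕ-fromℕ< j<C)) j+1<C)
          (kept (fromℕ< j<C) side)
      k+1<C : suc k < length C
      k+1<C = <-trans k+1<n n<C
      k≡0 : k ≡ 0
      k≡0 with k ≟ 0
      ... | yes eq = eq
      ... | no  k≢0 = ⊥-elim (keptInterior k (<-trans (n<1+n k) k+1<C) (inj₁ (≤-reflexive (toℕ-fromℕ< _)))
                        (n≢0⇒n>0 k≢0) k+1<C)
      n≡last : n ≡ length C ∸ 1
      n≡last with n ≟ length C ∸ 1
      ... | yes eq = eq
      ... | no  n≢ = ⊥-elim (keptInterior n n<C (inj₂ (≤-reflexive (sym (toℕ-fromℕ< _))))
                       (<-trans z<s k+1<n) (≤∧≢⇒< n<C (n≢ ∘′ cong (_∸ 1))))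

  whole-skipped : 3 ≤ length C → MaxChain u w C → MaxChain u w D → Earlier D C →
    Skipped u w C 0 (length C ∸ 1)
  whole-skipped {C = C} {D = D} 3≤C ((_ , refl) , lst , _) mcD@((_ , refl) , lstD , _) earlier =
    1<last 3≤C , last<length 3≤C , D , mcD , earlier , kept
    where
      1<last : ∀ {L} → 3 ≤ L → 1 < L ∸ 1
      1<last {suc (suc (suc _))} _ = s≤s (s≤s z≤n)
      1<last {suc zero}          (s≤s ())
      1<last {suc (suc zero)}    (s≤s (s≤s ()))
      last<length : ∀ {L} → 3 ≤ L → suc (L ∸ 1) ≤ L
      last<length {suc _} _ = ≤-refl
      kept : ∀ i → toℕ i ≤ 0 ⊎ length C ∸ 1 ≤ toℕ i → lookup C i ∈ D
      kept zero        _         = here refl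
      kept (suc _)     (inj₁ ())
      kept i@(suc _)   (inj₂ le) = subst (_∈ D) (sym (lookup-last {C = C} lst i le)) (Last⇒∈ {C = D} lstD)

  record TwoChainInterval (u w : List A) : Set where
    field
      left right     : List (List A)
      left-maxChain  : MaxChain u w left
      right-maxChain : MaxChain u w right
      only           : ∀ C → MaxChain u w C → C ≡ left ⊎ C ≡ right
      gap            : 2 + length u ≤ length w
      left-apart     : Interior (_∉ right) left
      right-apart    : Interior (_∉ left) right

  twoChains : TwoChainInterval u w → ExactlyTwoMaxChains u w × SecondHasUniqueMinSkipped u w
  twoChains {u} {w} T =
    (left , right , left-maxChain , right-maxChain , apart⇒≢ (maxChain-long gap left-maxChain) left-apart , only) ,
    second
    where
      open TwoChainInterval T
      apartFrom : MaxChain u w C → MaxChain u w D → Earlier D C → Interior (_∉ D) C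
      apartFrom {C} {D} mcC mcD earlier with only C mcC | only D mcD
      ... | inj₁ refl | inj₁ refl = ⊥-elim (Earlier-irrefl earlier)
      ... | inj₁ refl | inj₂ refl = left-apart
      ... | inj₂ refl | inj₁ refl = right-apart
      ... | inj₂ refl | inj₂ refl = ⊥-elim (Earlier-irrefl earlier)
      second : SecondHasUniqueMinSkipped u w
      second C mcC (D , mcD , earlier) k n = mk⇔
        (λ (skipped , _) → skipped-spans (apartFrom mcC) skipped)
        (λ { (refl , refl) → whole-skipped (maxChain-long gap mcC) mcC mcD earlier ,
                             λ _ _ skipped _ _ → skipped-spans (apartFrom mcC) skipped })

  interior₃ : P y → Interior P (x ∷ y ∷ z ∷ [])
  interior₃ py (suc zero)       _  _                        = py
  interior₃ py zero             () _
  interior₃ py (suc (suc zero)) _  (s≤s (s≤s (s≤s ())))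

  innerInterval : a ∷ m ≢ m ∷ʳ b → TwoChainInterval m (a ∷ m ∷ʳ b)
  innerInterval {a} {m} {b} a∷m≢m∷ʳb = record
    { left           = frontFirst
    ; right          = backFirst
    ; left-maxChain  = (_ , refl) , refl , ∷-⋖ refl ∷ ∷ʳ-⋖ refl ∷ [-]
    ; right-maxChain = (_ , refl) , refl , ∷ʳ-⋖ refl ∷ ∷-⋖ refl ∷ [-]
    ; only           = λ { _ ((r , refl) , lst , lk) → two r (+-cancelˡ-≡ (length m) (length r) 2
                             (trans (chain-length lk lst) (trans |W| (+-comm 2 (length m))))) lst lk }
    ; gap            = ≤-reflexive (sym |W|)
    ; left-apart     = interior₃ {P = _∉ backFirst} λ
        { (here eq)                 → ∷-≢ eq
        ; (there (here eq))         → a∷m≢m∷ʳb (sym eq)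
        ; (there (there (here eq))) → ∷ʳ-≢ (sym eq)
        ; (there (there (there ()))) }
    ; right-apart    = interior₃ {P = _∉ frontFirst} λ
        { (here eq)                 → ∷ʳ-≢ (∷-injectiveʳ eq)
        ; (there (here eq))         → a∷m≢m∷ʳb eq
        ; (there (there (here eq))) → ∷-≢ (sym eq)
        ; (there (there (there ()))) }
    }
    where
      W : List A
      W = a ∷ m ∷ʳ b
      frontFirst backFirst : List (List A)
      frontFirst = W ∷ (m ∷ʳ b) ∷ m ∷ []
      backFirst  = W ∷ (a ∷ m) ∷ m ∷ []
      |W| : length W ≡ 2 + length m
      |W| = cong suc (∷ʳ-length m b)
      two : ∀ r → length r ≡ 2 → Last m (W ∷ r) → Linked _⋗_ (W ∷ r) →
        W ∷ r ≡ frontFirst ⊎ W ∷ r ≡ backFirst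
      two (v ∷ _ ∷ []) _ refl (v⋖W ∷ _) with ⋖-cases v⋖W
      ... | inj₁ (_ , eq) = inj₁ (cong (λ v → W ∷ v ∷ m ∷ []) (∷-injectiveʳ eq))
      ... | inj₂ (_ , eq) = inj₂ (cong (λ v → W ∷ v ∷ m ∷ []) (∷ʳ-injectiveˡ v (a ∷ m) eq))

  module BorderInterval {a b : A} {m u : List A} (a∷m≢m∷ʳb : a ∷ m ≢ m ∷ʳ b)
    (uPrefix : ProperPrefix u (a ∷ m ∷ʳ b)) (uSuffix : ProperSuffix u (a ∷ m ∷ʳ b))
    (longest : ∀ v → ProperPrefix v (a ∷ m ∷ʳ b) → ProperSuffix v (a ∷ m ∷ʳ b) → length v ≤ length u)
    (u≮m : ¬ u <F m) where

    W : List A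
    W = a ∷ m ∷ʳ b

    squeeze : u ≤F y → y ≤F m → y ≡ u
    squeeze {y} u≤y y≤m = sym (≤F-length-≡ u≤y (≤-antisym (≤F-length u≤y) (≤F-length y≤u)))
      where
        y≤u : y ≤F u
        y≤u = subst (y ≤F_) (sym (≤F∧≮F⇒≡ (≤F-trans u≤y y≤m) u≮m)) y≤m

    prefix-step : ProperPrefix x W → x ⋗ y → u ≤F y → ProperPrefix y W
    prefix-step {y = y} (t , t≢[] , eq) y⋖x u≤y with ⋖-cases y⋖x
    ... | inj₂ (c , refl) = c ∷ t , (λ ()) , trans (sym (++-assoc y [ c ] t)) eq
    ... | inj₁ (c , refl) =
      subst (λ v → ProperPrefix v W) (sym (squeeze u≤y (away-from-ends⇒≤F-inner {p = [ c ]} eq (λ ()) t≢[]))) uPrefix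

    suffix-step : ProperSuffix x W → x ⋗ y → u ≤F y → ProperSuffix y W
    suffix-step {y = y} (q , q≢[] , eq) y⋖x u≤y with ⋖-cases y⋖x
    ... | inj₁ (c , refl) = q ∷ʳ c , (λ e → 0≢1+n (trans (sym (cong length e)) (∷ʳ-length q c))) ,
                            trans (++-assoc q [ c ] y) eq
    ... | inj₂ (c , refl) =
      subst (λ v → ProperSuffix v W) (sym (squeeze u≤y (away-from-ends⇒≤F-inner eq q≢[] (λ ())))) uSuffix

    gap : 2 + length u ≤ length W
    gap = ≤∧≢⇒< (properPrefix-length uPrefix) λ eq → a∷m≢m∷ʳb (trans (sym (u≡a∷m eq)) (u≡m∷ʳb eq))
      where
        u≡a∷m : suc (length u) ≡ length W → u ≡ a ∷ m
        u≡a∷m eq = prefix-unique (proper⇒prefix uPrefix) ([ b ] , refl) (trans (suc-injective eq) (∷ʳ-length m b))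
        u≡m∷ʳb : suc (length u) ≡ length W → u ≡ m ∷ʳ b
        u≡m∷ʳb eq = suffix-unique (proper⇒suffix uSuffix) ([ a ] , refl) (suc-injective eq)

    no-long-border : Prefix y W → Suffix y W → length u < length y → length y < length W → ⊥
    no-long-border {y} pre suf u<y y<W =
      <⇒≱ u<y (longest y (prefix⇒proper pre y<W) (suffix⇒proper suf y<W))

    backFirst frontFirst : List (List A)
    backFirst  = prefixChain u (proj₁ uPrefix)
    frontFirst = suffixChain (proj₁ uSuffix) u

    backFirst-maxChain : MaxChain u W backFirst
    backFirst-maxChain = prefixChain-maxChain {s = proj₁ uPrefix} (proj₂ (proj₂ uPrefix))

    frontFirst-maxChain : MaxChain u W frontFirst
    frontFirst-maxChain = suffixChain-maxChain {p = proj₁ uSuffix} (proj₂ (proj₂ uSuffix))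

    backFirst-prefixes : All (λ y → Prefix y W) backFirst
    backFirst-prefixes =
      subst (λ w → All (λ y → Prefix y w) backFirst) (proj₂ (proj₂ uPrefix)) (prefixChain-prefixes u _)

    frontFirst-suffixes : All (λ y → Suffix y W) frontFirst
    frontFirst-suffixes =
      subst (λ w → All (λ y → Suffix y w) frontFirst) (proj₂ (proj₂ uSuffix)) (suffixChain-suffixes _)

    -- the first step decides the chain: afterwards every element stays a prefix, resp. a suffix, of W
    only : ∀ C → MaxChain u W C → C ≡ backFirst ⊎ C ≡ frontFirst
    only _ (([] , refl) , lst , _) =
      ⊥-elim (<-irrefl (cong length (sym lst)) (<-trans (n<1+n (length u)) gap))
    only _ mc@((_ ∷ _ , refl) , lst , v⋖W ∷ lk) with ⋖-cases v⋖W
    ... | inj₂ (c , eq) = inj₁ (maxChain-unique prefix-unique mc backFirst-maxChain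
          (([] , ++-identityʳ W) ∷ All.map proper⇒prefix (all-along-chain prefix-step lk lst ([ c ] , (λ ()) , eq)))
          backFirst-prefixes)
    ... | inj₁ (c , eq) = inj₂ (maxChain-unique suffix-unique mc frontFirst-maxChain
          (([] , refl) ∷ All.map proper⇒suffix (all-along-chain suffix-step lk lst ([ c ] , (λ ()) , eq)))
          frontFirst-suffixes)

    interval : TwoChainInterval u W
    interval = record
      { left           = backFirst
      ; right          = frontFirst
      ; left-maxChain  = backFirst-maxChain
      ; right-maxChain = frontFirst-maxChain
      ; only           = only
      ; gap            = gap
      ; left-apart     = apart no-long-border backFirst-maxChain backFirst-prefixes frontFirst-suffixes
      ; right-apart    = apart (flip no-long-border) frontFirst-maxChain frontFirst-suffixes backFirst-prefixes
      }

  cons≡snoc⇒constant : a ∷ m ≡ m ∷ʳ b → All (_≡ a) (a ∷ m ∷ʳ b)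
  cons≡snoc⇒constant {m = []}    eq = refl ∷ sym (∷-injectiveˡ eq) ∷ []
  cons≡snoc⇒constant {m = _ ∷ _} eq with ∷-injectiveˡ eq
  ... | refl = refl ∷ cons≡snoc⇒constant (∷-injectiveʳ eq)

  ¬Flat⇒cons≢snoc : ¬ Flat (a ∷ m ∷ʳ b) → a ∷ m ≢ m ∷ʳ b
  ¬Flat⇒cons≢snoc {a = a} {m = m} {b = b} ¬flat eq =
    ¬flat λ x∈ y∈ → trans (All.lookup constant x∈) (sym (All.lookup constant y∈))
    where
      constant : All (_≡ a) (a ∷ m ∷ʳ b)
      constant = cons≡snoc⇒constant eq

  ends : (w : List A) → 2 ≤ length w → ∃[ a ] ∃[ m ] ∃[ b ] w ≡ a ∷ m ∷ʳ b
  ends (a ∷ w) (s≤s 1≤w) with reverseView w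
  ... | []         = contradiction 1≤w λ ()
  ... | m ∶ _ ∶ʳ b = a , m , b , refl

  take-length-++ : (m : List A) → take (length m) (m ++ t) ≡ m
  take-length-++ []      = refl
  take-length-++ (c ∷ m) = cong (c ∷_) (take-length-++ m)

  inner-∷-∷ʳ : (a : A) (m : List A) (b : A) → inner (a ∷ m ∷ʳ b) ≡ m
  inner-∷-∷ʳ a m b = trans (cong (λ n → take (n ∸ 1) (m ∷ʳ b)) (∷ʳ-length m b)) (take-length-++ m)

lemma2p4 : {A : Set} (w : List A) → ¬ Flat w → 2 ≤ length w →
    (ExactlyTwoMaxChains (inner w) w × SecondHasUniqueMinSkipped (inner w) w) ×
    (∀ u → IsO w u → ¬ (u <F inner w) →
      ExactlyTwoMaxChains u w × SecondHasUniqueMinSkipped u w)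
lemma2p4 w ¬flat 2≤w with ends w 2≤w
... | a , m , b , refl rewrite inner-∷-∷ʳ a m b =
  twoChains (innerInterval a∷m≢m∷ʳb) ,
  λ u (uPrefix , uSuffix , longest) u≮m →
    twoChains (BorderInterval.interval a∷m≢m∷ʳb uPrefix uSuffix longest u≮m)
  where
    a∷m≢m∷ʳb : a ∷ m ≢ m ∷ʳ b
    a∷m≢m∷ʳb = ¬Flat⇒cons≢snoc ¬flat
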